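{- Let $G$ be a graph with maximum degree at most $K\delta$. Let $x,y\in V(G)$ and let $i,j$ be nonnegative integers with $i+j<2k$. If $(x,y)$ is $(i,j)$-rich, then there exist $|V(H)|$ pairwise internally vertex-disjoint paths of length $2k$ in $G$ between $x$ and $y$.
   Context: Fix an integer $k\geq 1$, a multigraph $F$, $H=F^{2k-1}$ (the graph obtained from $F$ by replacing its edges with pairwise internally vertex-disjoint paths of length $2k$), and positive reals $K,\delta$. For $x\in V(G)$ and an integer $i\ge 0$, $\mathcal{P}_i(x)$ is the set of directed paths of length $i$ starting at $x$, and for $P\in\mathcal{P}_i(x)$, $v(P)$ is its endpoint. For nonnegative integers $i,j$ with $i+j<2k$, a pair $(x,y)$ of distinct vertices is $(i,j)$-rich if the number of pairs $(P,Q)\in \mathcal{P}_i(x)\times \mathcal{P}_j(y)$ such that there are at least $(|V(H)|+2)(2k+1)+1$ pairwise internally vertex-disjoint paths of length $2k-i-j$ between $v(P)$ and $v(Q)$ is more than $(2(i+j)|V(H)|(2k+1)+2(i+1)j)(K\delta)^{i+j-1}$. Otherwise (including when $x=y$) the pair is $(i,j)$-poor.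
   Formalization: The parameters $K,\delta$ are positive rationals rather than positive reals, so the maximum-degree bound and the richness threshold are taken at a rational value of Kδ. -}

module Defs where

open import Data.Bool using (Bool; true; false; T)
open import Data.Nat as ℕ using (ℕ; zero; suc)
open import Data.Fin using (Fin; zero; suc; fromℕ; inject₁)
open import Data.List using (List; length; filterᵇ; allFin)
open import Data.List.Relation.Unary.All using (All)
open import Data.List.Relation.Unary.AllPairs using (AllPairs)
open import Data.Product using (Σ; ∃; _×_; _,_)
open import Data.Sum using (_⊎_)
open import Data.Integer using (+_)
open import Data.Rational using (ℚ; _*_; _+_; _<_; _≤_; 1ℚ; 1/_; NonZero)
open import Data.Rational using () renaming (_/_ to _/ℚ_)
open import Relation.Binary.PropositionalEquality using (_≡_; _≢_)
open import Relation.Nullary using (¬_)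

ℕ→ℚ : ℕ → ℚ
ℕ→ℚ n = + n /ℚ 1

_^ℚ_ : ℚ → ℕ → ℚ
q ^ℚ zero  = 1ℚ
q ^ℚ suc n = q * (q ^ℚ n)

-- D ^ (e - 1), with integer exponent (so D ^ (0 - 1) = 1/D)
powPred : (D : ℚ) → .{{NonZero D}} → ℕ → ℚ
powPred D zero    = 1/ D
powPred D (suc e) = D ^ℚ e

record SimpleGraph (n : ℕ) : Set where
  field
    adj   : Fin n → Fin n → Bool
    sym   : ∀ u v → adj u v ≡ adj v u
    irrfl : ∀ v → adj v v ≡ false

module _ {n : ℕ} (G : SimpleGraph n) where
  open SimpleGraph G

  Adj : Fin n → Fin n → Set
  Adj u v = T (adj u v)

  degree : Fin n → ℕ
  degree v = length (filterᵇ (adj v) (allFin n))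

  MaxDegreeAtMost : ℚ → Set
  MaxDegreeAtMost D = ∀ v → ℕ→ℚ (degree v) ≤ D

  record DPath (ℓ : ℕ) : Set where
    field
      vtx  : Fin (suc ℓ) → Fin n
      step : ∀ (i : Fin ℓ) → Adj (vtx (inject₁ i)) (vtx (suc i))
      distinct : ∀ a b → vtx a ≡ vtx b → a ≡ b

  open DPath public

  start : ∀ {ℓ} → DPath ℓ → Fin n
  start P = vtx P zero

  end : ∀ {ℓ} → DPath ℓ → Fin n
  end {ℓ} P = vtx P (fromℕ ℓ)

  𝒫 : ℕ → Fin n → Set
  𝒫 ℓ x = Σ (DPath ℓ) λ P → start P ≡ x

  PathBetween : ℕ → Fin n → Fin n → Set
  PathBetween ℓ u v = Σ (DPath ℓ) λ P → (start P ≡ u) × (end P ≡ v)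

  Differ : ∀ {ℓ} → DPath ℓ → DPath ℓ → Set
  Differ {ℓ} P Q = ∃ λ (a : Fin (suc ℓ)) → vtx P a ≢ vtx Q a

  Internal : ∀ {ℓ} → Fin (suc ℓ) → Set
  Internal {ℓ} a = (a ≢ zero) × (a ≢ fromℕ ℓ)

  InternallyDisjoint : ∀ {ℓ} → DPath ℓ → DPath ℓ → Set
  InternallyDisjoint P Q =
    ∀ a b → Internal a → Internal b → vtx P a ≢ vtx Q b

  DisjointPaths : ℕ → ℕ → Fin n → Fin n → Set
  DisjointPaths m ℓ u v =
    Σ (Fin m → PathBetween ℓ u v) λ ps →
      ∀ a b → a ≢ b →
        Differ (Data.Product.proj₁ (ps a)) (Data.Product.proj₁ (ps b))
        × InternallyDisjoint (Data.Product.proj₁ (ps a)) (Data.Product.proj₁ (ps b))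

  PairDiffer : ∀ {i j} → DPath i × DPath j → DPath i × DPath j → Set
  PairDiffer (P , Q) (P′ , Q′) = Differ P P′ ⊎ Differ Q Q′

-- A finite multigraph: vertex set Fin vertices, edges a list
-- (repetitions allowed) of pairs of endpoints.
record Multigraph : Set where
  field
    vertices : ℕ
    edges    : List (Fin vertices × Fin vertices)

-- |V(F^{2k-1})|: every edge of F is replaced by a path of length 2k,
-- which contributes 2k-1 new internal vertices.
subdivisionOrder : Multigraph → ℕ → ℕ
subdivisionOrder F k =
  Multigraph.vertices F ℕ.+ ((2 ℕ.* k) ℕ.∸ 1) ℕ.* length (Multigraph.edges F)

module _ {n : ℕ} (G : SimpleGraph n) (k vH : ℕ)
         (D : ℚ) .{{_ : NonZero D}} where

  richCoeff : ℕ → ℕ → ℕ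
  richCoeff i j = 2 ℕ.* (i ℕ.+ j) ℕ.* vH ℕ.* (2 ℕ.* k ℕ.+ 1)
                  ℕ.+ 2 ℕ.* (i ℕ.+ 1) ℕ.* j

  richThreshold : ℕ → ℕ → ℚ
  richThreshold i j = ℕ→ℚ (richCoeff i j) * powPred D (i ℕ.+ j)

  GoodPair : ∀ {i j} → DPath G i × DPath G j → Set
  GoodPair {i} {j} (P , Q) =
    DisjointPaths G ((vH ℕ.+ 2) ℕ.* (2 ℕ.* k ℕ.+ 1) ℕ.+ 1)
                    ((2 ℕ.* k) ℕ.∸ (i ℕ.+ j)) (end G P) (end G Q)

  -- (x,y) is (i,j)-rich: x ≠ y and the number of pairs
  -- (P,Q) ∈ 𝒫_i(x) × 𝒫_j(y) with GoodPair exceeds the threshold,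
  -- i.e. there is a list of pairwise different such pairs whose length
  -- exceeds the threshold.
  Rich : ℕ → ℕ → Fin n → Fin n → Set
  Rich i j x y =
    (x ≢ y) ×
    Σ (List (DPath G i × DPath G j)) λ L →
      AllPairs (PairDiffer G) L ×
      All (λ { (P , Q) → (start G P ≡ x) × (start G Q ≡ y) × GoodPair (P , Q) }) L ×
      (richThreshold i j < ℕ→ℚ (length L))

module Submission where

-- The paths are chosen greedily.  Given t < |V(H)| of them, let S be x, y and
-- their interior vertices, so |S| ≤ |V(H)|(2k+1).  Call a pair (P, Q) of paths
-- from x and y blocked if P or Q meets S after its first vertex, or P and Q
-- meet after their first vertices.  If some pair counted by richness is
-- unblocked, one of its many connecting paths avoids S and P and Q
-- (pigeonhole), and P, that connector and Q reversed form a new path.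
-- Otherwise all counted pairs are blocked; but a blocked pair is determined by
-- its blocking event (i|S| + j|S| + ij choices) and the neighbour indices of
-- its other i+j-1 steps (fewer than Δ ≤ Kδ choices each), so there are at most
-- (i|S| + j|S| + ij)·Δ^(i+j-1) of them, which is below the richness threshold.

open import Defs
open import Data.Bool using (T)
open import Data.Bool.Properties using (T?)
open import Data.Nat as ℕ using (ℕ; zero; suc; _+_; _*_; _∸_; _^_; _≤_; _<_; _≥_; z≤n; s≤s; _≤?_; _<?_)
import Data.Nat.Properties as ℕP
open import Data.Nat.Tactic.RingSolver using (solve-∀)
open import Data.Fin using (Fin; zero; suc; toℕ; fromℕ; fromℕ<; inject₁)
import Data.Fin.Properties as FinP
open import Data.List as List using (List; []; _∷_; _++_; length; applyUpTo; upTo; lookup; allFin; filterᵇ)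
import Data.List.Properties as ListP
open import Data.List.Extrema.Nat using (argmax; f[xs]≤f[argmax])
open import Data.List.Membership.Propositional using (_∈_)
import Data.List.Membership.Propositional.Properties as ∈P
import Data.List.Membership.Setoid.Properties as ∈ₛP
open import Data.List.Relation.Unary.Any as Any using (here; there)
open import Data.List.Relation.Unary.All as All using (All; []; _∷_)
import Data.List.Relation.Unary.All.Properties as AllP
open import Data.List.Relation.Unary.AllPairs using (AllPairs; _∷_)
open import Data.Product using (Σ; ∃; _×_; _,_; proj₁; proj₂)
open import Data.Sum using (_⊎_; inj₁; inj₂; [_,_])
open import Data.Empty using (⊥-elim)
open import Relation.Nullary using (¬_; Dec; yes; no; _×-dec_)
open import Relation.Binary.PropositionalEquality hiding ([_])
open import Function using (_∘_)
open import Relation.Binary.Definitions using (tri<; tri≈; tri>)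
import Data.Integer as ℤ
import Data.Integer.Properties as ℤP
open import Data.Rational as ℚ using (ℚ; Positive; mkℚ; *≤*; *<*; NonNegative; nonNegative) renaming (_*_ to _*ℚ_)
open import Data.Rational.Properties using (pos*pos⇒pos; pos⇒nonZero)
import Data.Rational.Properties as ℚP
import Data.Nat.Coprimality as Coprime

radix-bound : ∀ {a b B N} → a < B → b < N → a + B * b < B * N
radix-bound {a} {b} {B} {N} a<B b<N = begin-strict
  a + B * b     <⟨ ℕP.+-monoˡ-< (B * b) a<B ⟩
  B + B * b     ≡⟨ ℕP.*-suc B b ⟨
  B * suc b     ≤⟨ ℕP.*-monoʳ-≤ B b<N ⟩
  B * N         ∎
  where open ℕP.≤-Reasoning

radix-<-high : ∀ {a a' b b' B} → a < B → b < b' → a + B * b < a' + B * b'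
radix-<-high {a} {a'} {b} {b'} {B} a<B b<b' =
  ℕP.<-≤-trans (radix-bound a<B b<b') (ℕP.m≤n+m (B * b') a')

radix-injective : ∀ {a a' b b' B} → a < B → a' < B →
                  a + B * b ≡ a' + B * b' → a ≡ a' × b ≡ b'
radix-injective {a} {a'} {b} {b'} {B} a<B a'<B e with ℕP.<-cmp b b'
... | tri< b<b' _ _ = ⊥-elim (ℕP.<⇒≢ (radix-<-high {a' = a'} a<B b<b') e)
... | tri> _ _ b'<b = ⊥-elim (ℕP.<⇒≢ (radix-<-high {a' = a} a'<B b'<b) (sym e))
... | tri≈ _ refl _ = ℕP.+-cancelʳ-≡ (B * b) a a' e , refl

module Numeral (d : ℕ) where

  numeral : (ℕ → ℕ) → List ℕ → ℕ
  numeral f []       = 0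
  numeral f (p ∷ ps) = f p + d * numeral f ps

  numeral-bound : ∀ f ps → All (λ p → f p < d) ps → numeral f ps < d ^ length ps
  numeral-bound f []       []       = s≤s z≤n
  numeral-bound f (p ∷ ps) (h ∷ hs) = radix-bound h (numeral-bound f ps hs)

  numeral-injective : ∀ f g ps → All (λ p → f p < d) ps → All (λ p → g p < d) ps →
                      numeral f ps ≡ numeral g ps → All (λ p → f p ≡ g p) ps
  numeral-injective f g []       _        _        _ = []
  numeral-injective f g (p ∷ ps) (h ∷ hs) (h' ∷ hs') e =
    let fp≡gp , rest≡ = radix-injective h h' e
    in fp≡gp ∷ numeral-injective f g ps hs hs' rest≡

positionsExcept : ℕ → ℕ → List ℕ
positionsExcept u N = upTo u ++ applyUpTo (suc u +_) (N ∸ suc u)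

length-positionsExcept : ∀ {u N} → u < N → length (positionsExcept u N) ≡ N ∸ 1
length-positionsExcept {u} {N} u<N = begin
  length (upTo u ++ applyUpTo (suc u +_) (N ∸ suc u))  ≡⟨ ListP.length-++ (upTo u) ⟩
  length (upTo u) + length (applyUpTo (suc u +_) (N ∸ suc u))
    ≡⟨ cong₂ _+_ (ListP.length-upTo u) (ListP.length-applyUpTo (suc u +_) (N ∸ suc u)) ⟩
  u + (N ∸ suc u)                                      ≡⟨⟩
  suc u + (N ∸ suc u) ∸ 1                              ≡⟨ cong (_∸ 1) (ℕP.m+[n∸m]≡n u<N) ⟩
  N ∸ 1                                                ∎
  where open ≡-Reasoning

∈-positionsExcept : ∀ {u N p} → p < N → p ≢ u → p ∈ positionsExcept u N
∈-positionsExcept {u} {N} {p} p<N p≢u with ℕP.<-cmp p u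
... | tri< p<u _ _ = ∈P.∈-++⁺ˡ (∈P.∈-upTo⁺ p<u)
... | tri≈ _ p≡u _ = ⊥-elim (p≢u p≡u)
... | tri> _ _ u<p = ∈P.∈-++⁺ʳ (upTo u) (subst (_∈ _) (ℕP.m+[n∸m]≡n u<p) (∈P.∈-applyUpTo⁺ (suc u +_) offset<))
  where
  offset< : p ∸ suc u < N ∸ suc u
  offset< = ℕP.∸-monoˡ-< p<N u<p

All-positionsExcept : ∀ {Q : ℕ → Set} {u N} → u < N → (∀ p → p < N → Q p) →
                      All Q (positionsExcept u N)
All-positionsExcept {u = u} {N} u<N hQ = AllP.++⁺
  (AllP.applyUpTo⁺₁ (λ p → p) u (λ p<u → hQ _ (ℕP.<-trans p<u u<N)))
  (AllP.applyUpTo⁺₁ (suc u +_) (N ∸ suc u)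
    (λ {p} p< → hQ _ (subst (suc u + p <_) (ℕP.m+[n∸m]≡n u<N) (ℕP.+-monoʳ-< (suc u) p<))))

AllPairs-lookup : ∀ {A : Set} {R : A → A → Set} {L : List A} → AllPairs R L →
                  (k k' : Fin (length L)) → toℕ k < toℕ k' → R (lookup L k) (lookup L k')
AllPairs-lookup (r ∷ rs) zero     (suc k') _         = All.lookup r (∈P.∈-lookup k')
AllPairs-lookup (r ∷ rs) (suc k)  (suc k') (s≤s k<k') = AllPairs-lookup rs k k' k<k'

coded-pairwise-length≤ :
  ∀ {A : Set} {R : A → A → Set} {B : A → Set} (code : ∀ {e} → B e → ℕ) (N : ℕ) →
  (∀ {e} (b : B e) → code b < N) →
  (∀ {e e'} (b : B e) (b' : B e') → code b ≡ code b' → ¬ R e e') →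
  (L : List A) → AllPairs R L → All B L → length L ≤ N
coded-pairwise-length≤ {A} {R} {B} code N code< code-sep L related hasB with length L ≤? N
... | yes L≤N = L≤N
... | no L≰N with FinP.pigeonhole (ℕP.≰⇒> L≰N) codeAt
  where
  codeAt : Fin (length L) → Fin N
  codeAt k = fromℕ< (code< (All.lookup hasB (∈P.∈-lookup k)))
... | k , k' , k<k' , e = ⊥-elim (code-sep (hasBAt k) (hasBAt k') same-code (AllPairs-lookup related k k' k<k'))
  where
  hasBAt : (k : Fin (length L)) → B (lookup L k)
  hasBAt k = All.lookup hasB (∈P.∈-lookup k)
  same-code : code (hasBAt k) ≡ code (hasBAt k')
  same-code = begin
    code (hasBAt k)                     ≡⟨ FinP.toℕ-fromℕ< (code< (hasBAt k)) ⟨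
    toℕ (fromℕ< (code< (hasBAt k)))     ≡⟨ cong toℕ e ⟩
    toℕ (fromℕ< (code< (hasBAt k')))    ≡⟨ FinP.toℕ-fromℕ< (code< (hasBAt k')) ⟩
    code (hasBAt k')                    ∎
    where open ≡-Reasoning

ℕ→ℚ-normal : ∀ n → ℕ→ℚ n ≡ mkℚ (ℤ.+ n) 0 (Coprime.sym (Coprime.1-coprimeTo n))
ℕ→ℚ-normal n = ℚP.normalize-coprime (Coprime.sym (Coprime.1-coprimeTo n))

ℕ→ℚ-mono-≤ : ∀ {a b} → a ≤ b → ℕ→ℚ a ℚ.≤ ℕ→ℚ b
ℕ→ℚ-mono-≤ {a} {b} a≤b rewrite ℕ→ℚ-normal a | ℕ→ℚ-normal b =
  *≤* (subst₂ ℤ._≤_ (sym (ℤP.*-identityʳ (ℤ.+ a))) (sym (ℤP.*-identityʳ (ℤ.+ b))) (ℤ.+≤+ a≤b))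

ℕ→ℚ-cancel-< : ∀ {a b} → ℕ→ℚ a ℚ.< ℕ→ℚ b → a < b
ℕ→ℚ-cancel-< {a} {b} a<b rewrite ℕ→ℚ-normal a | ℕ→ℚ-normal b with a<b
... | *<* a*1<b*1 with subst₂ ℤ._<_ (ℤP.*-identityʳ (ℤ.+ a)) (ℤP.*-identityʳ (ℤ.+ b)) a*1<b*1
...   | ℤ.+<+ a<b' = a<b'

ℕ→ℚ-* : ∀ a b → ℕ→ℚ (a * b) ≡ ℕ→ℚ a *ℚ ℕ→ℚ b
ℕ→ℚ-* a b rewrite ℕ→ℚ-normal a | ℕ→ℚ-normal b = cong (ℚ._/ 1) (ℤP.pos-* a b)

ℕ→ℚ-nonNeg : ∀ n → NonNegative (ℕ→ℚ n)
ℕ→ℚ-nonNeg n rewrite ℕ→ℚ-normal n = _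

ℕ→ℚ-^-≤ : ∀ (d : ℕ) (D : ℚ) → ℕ→ℚ d ℚ.≤ D → ∀ e → ℕ→ℚ (d ^ e) ℚ.≤ D ^ℚ e
ℕ→ℚ-^-≤ d D d≤D zero    = ℚP.≤-refl
ℕ→ℚ-^-≤ d D d≤D (suc e) = begin
  ℕ→ℚ (d * d ^ e)          ≡⟨ ℕ→ℚ-* d (d ^ e) ⟩
  ℕ→ℚ d *ℚ ℕ→ℚ (d ^ e)     ≤⟨ ℚP.*-monoʳ-≤-nonNeg (ℕ→ℚ (d ^ e)) {{ℕ→ℚ-nonNeg (d ^ e)}} d≤D ⟩
  D *ℚ ℕ→ℚ (d ^ e)         ≤⟨ ℚP.*-monoˡ-≤-nonNeg D {{D≥0}} (ℕ→ℚ-^-≤ d D d≤D e) ⟩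
  D *ℚ D ^ℚ e              ∎
  where
  open ℚP.≤-Reasoning
  D≥0 : NonNegative D
  D≥0 = nonNegative (ℚP.≤-trans (ℚP.nonNegative⁻¹ (ℕ→ℚ d) {{ℕ→ℚ-nonNeg d}}) d≤D)

threshold⇒count : ∀ (d c C ℓ e : ℕ) (D : ℚ) .{{_ : ℚ.NonZero D}} →
                  ℕ→ℚ d ℚ.≤ D → C ≤ c → (e ≡ 0 → c ≡ 0) →
                  ℕ→ℚ c *ℚ powPred D e ℚ.< ℕ→ℚ ℓ → C * d ^ (e ∸ 1) < ℓ
threshold⇒count d c C ℓ zero D d≤D C≤c c≡0 ℓ> with c≡0 refl | C≤c
... | refl | z≤n = ℕ→ℚ-cancel-< (subst (ℚ._< ℕ→ℚ ℓ) (ℚP.*-zeroˡ (powPred D 0)) ℓ>)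
threshold⇒count d c C ℓ (suc e) D d≤D C≤c c≡0 ℓ> = ℕ→ℚ-cancel-< (ℚP.≤-<-trans count≤threshold ℓ>)
  where
  open ℚP.≤-Reasoning
  count≤threshold : ℕ→ℚ (C * d ^ e) ℚ.≤ ℕ→ℚ c *ℚ D ^ℚ e
  count≤threshold = begin
    ℕ→ℚ (C * d ^ e)          ≡⟨ ℕ→ℚ-* C (d ^ e) ⟩
    ℕ→ℚ C *ℚ ℕ→ℚ (d ^ e)     ≤⟨ ℚP.*-monoʳ-≤-nonNeg (ℕ→ℚ (d ^ e)) {{ℕ→ℚ-nonNeg (d ^ e)}} (ℕ→ℚ-mono-≤ C≤c) ⟩
    ℕ→ℚ c *ℚ ℕ→ℚ (d ^ e)     ≤⟨ ℚP.*-monoˡ-≤-nonNeg (ℕ→ℚ c) {{ℕ→ℚ-nonNeg c}} (ℕ→ℚ-^-≤ d D d≤D e) ⟩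
    ℕ→ℚ c *ℚ D ^ℚ e          ∎

-- Size bounds for the greedy construction.  With t < vH paths of length ℓ in
-- hand, the used vertices x, y and the interiors number 2 + t(ℓ-1) ≤ vH(ℓ+1).
used≤ : ∀ t vH ℓ → 1 ≤ ℓ → t < vH → 2 + t * (ℓ ∸ 1) ≤ vH * suc ℓ
used≤ t vH ℓ 1≤ℓ t<vH = begin
  2 + t * (ℓ ∸ 1)   ≤⟨ ℕP.+-mono-≤ (s≤s 1≤ℓ) (ℕP.*-monoʳ-≤ t (ℕP.≤-trans (ℕP.m∸n≤m ℓ 1) (ℕP.n≤1+n ℓ))) ⟩
  suc ℓ + t * suc ℓ ≡⟨⟩
  suc t * suc ℓ     ≤⟨ ℕP.*-monoˡ-≤ (suc ℓ) t<vH ⟩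
  vH * suc ℓ        ∎
  where open ℕP.≤-Reasoning

-- The number of blocking events is within the richness coefficient.
events≤coefficient : ∀ i j s vH X → s ≤ vH * X →
                     i * s + j * s + i * j ≤ 2 * (i + j) * vH * X + 2 * (i + 1) * j
events≤coefficient i j s vH X s≤vHX = ℕP.+-mono-≤ hits meets
  where
  open ℕP.≤-Reasoning
  hits : i * s + j * s ≤ 2 * (i + j) * vH * X
  hits = begin
    i * s + j * s                         ≡⟨ ℕP.*-distribʳ-+ s i j ⟨
    (i + j) * s                           ≤⟨ ℕP.*-monoʳ-≤ (i + j) s≤vHX ⟩
    (i + j) * (vH * X)                    ≤⟨ ℕP.m≤m+n _ ((i + j) * (vH * X) + 0) ⟩
    2 * ((i + j) * (vH * X))              ≡⟨ reassociate i j vH X ⟩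
    2 * (i + j) * vH * X                  ∎
    where
    reassociate : ∀ i j vH X → 2 * ((i + j) * (vH * X)) ≡ 2 * (i + j) * vH * X
    reassociate = solve-∀
  meets : i * j ≤ 2 * (i + 1) * j
  meets = ℕP.*-monoˡ-≤ j (ℕP.≤-trans (ℕP.m≤m+n i 1) (ℕP.m≤m+n (i + 1) ((i + 1) + 0)))

-- More connectors than vertices a connector must avoid.
enough-connectors : ∀ s i j vH X → s ≤ vH * X → suc i + suc j ≤ X →
                    s + (suc i + suc j) < (vH + 2) * X + 1
enough-connectors s i j vH X s≤vHX pair≤X = begin-strict
  s + (suc i + suc j) ≤⟨ ℕP.+-mono-≤ s≤vHX pair≤X ⟩
  vH * X + X          ≤⟨ ℕP.m≤m+n (vH * X + X) X ⟩
  vH * X + X + X      ≡⟨ regroup vH X ⟩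
  (vH + 2) * X        <⟨ ℕP.n<1+n _ ⟩
  suc ((vH + 2) * X)  ≡⟨ ℕP.+-comm 1 _ ⟩
  (vH + 2) * X + 1    ∎
  where
  open ℕP.≤-Reasoning
  regroup : ∀ vH X → vH * X + X + X ≡ (vH + 2) * X
  regroup = solve-∀

-- The three pieces of a spliced path have lengths adding up to ℓ.
pieces-length : ∀ i j ℓ → i + j ≤ ℓ → i + (ℓ ∸ (i + j)) + j ≡ ℓ
pieces-length i j ℓ i+j≤ℓ = begin
  i + m + j   ≡⟨ ℕP.+-assoc i m j ⟩
  i + (m + j) ≡⟨ cong (i +_) (ℕP.+-comm m j) ⟩
  i + (j + m) ≡⟨ ℕP.+-assoc i j m ⟨
  i + j + m   ≡⟨ ℕP.m+[n∸m]≡n i+j≤ℓ ⟩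
  ℓ           ∎
  where
  open ≡-Reasoning
  m = ℓ ∸ (i + j)

module InGraph {n : ℕ} (G : SimpleGraph n) where

  -- The vertex of a path at a position given as a natural number.
  at : ∀ {ℓ} → DPath G ℓ → ℕ → Fin n
  at {ℓ} P p with p <? suc ℓ
  ... | yes p≤ℓ = vtx P (fromℕ< p≤ℓ)
  ... | no _    = vtx P zero

  at-fromℕ< : ∀ {ℓ} (P : DPath G ℓ) {p} (p≤ℓ : p < suc ℓ) → at P p ≡ vtx P (fromℕ< p≤ℓ)
  at-fromℕ< {ℓ} P {p} p≤ℓ with p <? suc ℓ
  ... | yes _  = refl
  ... | no p≰ℓ = ⊥-elim (p≰ℓ p≤ℓ)

  at-toℕ : ∀ {ℓ} (P : DPath G ℓ) (a : Fin (suc ℓ)) → at P (toℕ a) ≡ vtx P a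
  at-toℕ P a = trans (at-fromℕ< P (FinP.toℕ<n a)) (cong (vtx P) (FinP.fromℕ<-toℕ a (FinP.toℕ<n a)))

  at-start : ∀ {ℓ} (P : DPath G ℓ) → at P 0 ≡ start G P
  at-start P = at-toℕ P zero

  at-end : ∀ {ℓ} (P : DPath G ℓ) → at P ℓ ≡ end G P
  at-end {ℓ} P = trans (cong (at P) (sym (FinP.toℕ-fromℕ ℓ))) (at-toℕ P (fromℕ ℓ))

  at-adjacent : ∀ {ℓ} (P : DPath G ℓ) {p} → p < ℓ → Adj G (at P p) (at P (suc p))
  at-adjacent {ℓ} P {p} p<ℓ = subst₂ (Adj G) from-inject from-suc (step P k)
    where
    k : Fin ℓ
    k = fromℕ< p<ℓ
    from-inject : vtx P (inject₁ k) ≡ at P p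
    from-inject = trans (sym (at-toℕ P (inject₁ k)))
                        (cong (at P) (trans (FinP.toℕ-inject₁ k) (FinP.toℕ-fromℕ< p<ℓ)))
    from-suc : vtx P (suc k) ≡ at P (suc p)
    from-suc = trans (sym (at-toℕ P (suc k))) (cong (at P ∘ suc) (FinP.toℕ-fromℕ< p<ℓ))

  at-injective : ∀ {ℓ} (P : DPath G ℓ) {p q} → p ≤ ℓ → q ≤ ℓ → at P p ≡ at P q → p ≡ q
  at-injective P {p} {q} p≤ℓ q≤ℓ e = begin
    p                       ≡⟨ FinP.toℕ-fromℕ< (s≤s p≤ℓ) ⟨
    toℕ (fromℕ< (s≤s p≤ℓ))  ≡⟨ cong toℕ (distinct P _ _ same-vertex) ⟩
    toℕ (fromℕ< (s≤s q≤ℓ))  ≡⟨ FinP.toℕ-fromℕ< (s≤s q≤ℓ) ⟩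
    q                       ∎
    where
    open ≡-Reasoning
    same-vertex = trans (sym (at-fromℕ< P (s≤s p≤ℓ))) (trans e (at-fromℕ< P (s≤s q≤ℓ)))

  vertices : ∀ {ℓ} → DPath G ℓ → List (Fin n)
  vertices {ℓ} P = List.map (at P) (upTo (suc ℓ))

  ∈-vertices : ∀ {ℓ} (P : DPath G ℓ) {a} → a ≤ ℓ → at P a ∈ vertices P
  ∈-vertices P a≤ℓ = ∈P.∈-map⁺ (at P) (∈P.∈-upTo⁺ (s≤s a≤ℓ))

  length-vertices : ∀ {ℓ} (P : DPath G ℓ) → length (vertices P) ≡ suc ℓ
  length-vertices {ℓ} P = trans (ListP.length-map (at P) (upTo (suc ℓ))) (ListP.length-upTo (suc ℓ))

  differ-at : ∀ {ℓ} (P Q : DPath G ℓ) {p} → p ≤ ℓ → at P p ≢ at Q p → Differ G P Q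
  differ-at P Q {p} p≤ℓ ne =
    fromℕ< (s≤s p≤ℓ) , λ e → ne (trans (at-fromℕ< P (s≤s p≤ℓ)) (trans e (sym (at-fromℕ< Q (s≤s p≤ℓ)))))

  agree⇒¬differ : ∀ {ℓ} (P Q : DPath G ℓ) → (∀ p → p ≤ ℓ → at P p ≡ at Q p) → ¬ Differ G P Q
  agree⇒¬differ {ℓ} P Q agree (a , ne) =
    ne (trans (sym (at-toℕ P a)) (trans (agree (toℕ a) (ℕP.≤-pred (FinP.toℕ<n a))) (at-toℕ Q a)))

  internal⇒bounds : ∀ {ℓ} {a : Fin (suc ℓ)} → Internal G a → 1 ≤ toℕ a × toℕ a < ℓ
  internal⇒bounds {ℓ} {zero}  (a≢0 , _)    = ⊥-elim (a≢0 refl)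
  internal⇒bounds {ℓ} {suc a} (_ , a≢ℓ) =
    s≤s z≤n , ℕP.≤∧≢⇒< (ℕP.≤-pred (FinP.toℕ<n (suc a)))
                       (λ e → a≢ℓ (FinP.toℕ-injective (trans e (sym (FinP.toℕ-fromℕ ℓ)))))

  bounds⇒internal : ∀ {ℓ p} → 1 ≤ p → (p<ℓ : p < ℓ) → Internal G {ℓ} (fromℕ< (ℕP.m<n⇒m<1+n p<ℓ))
  bounds⇒internal {ℓ} {p} 1≤p p<ℓ =
    (λ e → ℕP.<⇒≢ 1≤p (sym (trans (sym (FinP.toℕ-fromℕ< (ℕP.m<n⇒m<1+n p<ℓ))) (cong toℕ e)))) ,
    (λ e → ℕP.<⇒≢ p<ℓ (trans (sym (FinP.toℕ-fromℕ< (ℕP.m<n⇒m<1+n p<ℓ)))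
                             (trans (cong toℕ e) (FinP.toℕ-fromℕ ℓ))))

  InteriorsDisjoint : ∀ {ℓ} → DPath G ℓ → DPath G ℓ → Set
  InteriorsDisjoint {ℓ} P Q = ∀ p q → 1 ≤ p → p < ℓ → 1 ≤ q → q < ℓ → at P p ≢ at Q q

  internallyDisjoint⇒ : ∀ {ℓ} (P Q : DPath G ℓ) → InternallyDisjoint G P Q → InteriorsDisjoint P Q
  internallyDisjoint⇒ P Q disj p q 1≤p p<ℓ 1≤q q<ℓ e =
    disj _ _ (bounds⇒internal 1≤p p<ℓ) (bounds⇒internal 1≤q q<ℓ)
      (trans (sym (at-fromℕ< P (ℕP.m<n⇒m<1+n p<ℓ))) (trans e (at-fromℕ< Q (ℕP.m<n⇒m<1+n q<ℓ))))

  ⇒internallyDisjoint : ∀ {ℓ} (P Q : DPath G ℓ) → InteriorsDisjoint P Q → InternallyDisjoint G P Q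
  ⇒internallyDisjoint P Q disj a b a-int b-int e =
    disj (toℕ a) (toℕ b) (proj₁ (internal⇒bounds a-int)) (proj₂ (internal⇒bounds a-int))
                         (proj₁ (internal⇒bounds b-int)) (proj₂ (internal⇒bounds b-int))
      (trans (at-toℕ P a) (trans e (sym (at-toℕ Q b))))

  -- A path of length ℓ as an ℕ-indexed vertex sequence, adjacent and injective
  -- on positions 0 … ℓ.  This form is closed under reversal and concatenation.
  record PathSeq (ℓ : ℕ) : Set where
    field
      seq       : ℕ → Fin n
      adjacent  : ∀ p → p < ℓ → Adj G (seq p) (seq (suc p))
      injective : ∀ p q → p ≤ ℓ → q ≤ ℓ → seq p ≡ seq q → p ≡ q
  open PathSeq public

  toSeq : ∀ {ℓ} → DPath G ℓ → PathSeq ℓ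
  toSeq P = record
    { seq = at P ; adjacent = λ p → at-adjacent P ; injective = λ p q → at-injective P }

  fromSeq : ∀ {ℓ} → PathSeq ℓ → DPath G ℓ
  fromSeq {ℓ} W = record
    { vtx      = λ a → seq W (toℕ a)
    ; step     = λ k → subst (λ p → Adj G (seq W p) (seq W (suc (toℕ k))))
                              (sym (FinP.toℕ-inject₁ k)) (adjacent W (toℕ k) (FinP.toℕ<n k))
    ; distinct = λ a b e → FinP.toℕ-injective
                   (injective W _ _ (ℕP.≤-pred (FinP.toℕ<n a)) (ℕP.≤-pred (FinP.toℕ<n b)) e) }

  at-fromSeq : ∀ {ℓ} (W : PathSeq ℓ) p → p ≤ ℓ → at (fromSeq W) p ≡ seq W p
  at-fromSeq W p p≤ℓ = trans (at-fromℕ< (fromSeq W) (s≤s p≤ℓ)) (cong (seq W) (FinP.toℕ-fromℕ< (s≤s p≤ℓ)))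

  castSeq : ∀ {ℓ ℓ'} → ℓ ≡ ℓ' → PathSeq ℓ → PathSeq ℓ'
  castSeq refl W = W

  seq-castSeq : ∀ {ℓ ℓ'} (e : ℓ ≡ ℓ') (W : PathSeq ℓ) p → seq (castSeq e W) p ≡ seq W p
  seq-castSeq refl W p = refl

  Adj-sym : ∀ {u v} → Adj G u v → Adj G v u
  Adj-sym {u} {v} = subst T (SimpleGraph.sym G u v)

  reverse : ∀ {ℓ} → PathSeq ℓ → PathSeq ℓ
  reverse {ℓ} W = record
    { seq       = λ p → seq W (ℓ ∸ p)
    ; adjacent  = λ p p<ℓ → subst (λ q → Adj G (seq W q) (seq W (ℓ ∸ suc p))) (sym (ℓ∸p≡suc p<ℓ))
                                  (Adj-sym (adjacent W (ℓ ∸ suc p) (ℓ∸suc<ℓ p<ℓ)))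
    ; injective = λ p q p≤ℓ q≤ℓ e →
        ℕP.∸-cancelˡ-≡ p≤ℓ q≤ℓ (injective W _ _ (ℕP.m∸n≤m ℓ p) (ℕP.m∸n≤m ℓ q) e) }
    where
    ℓ∸p≡suc : ∀ {p} → p < ℓ → ℓ ∸ p ≡ suc (ℓ ∸ suc p)
    ℓ∸p≡suc p<ℓ = ℕP.+-∸-assoc 1 p<ℓ
    ℓ∸suc<ℓ : ∀ {p} → p < ℓ → ℓ ∸ suc p < ℓ
    ℓ∸suc<ℓ {p} p<ℓ = subst (_≤ ℓ) (ℓ∸p≡suc p<ℓ) (ℕP.m∸n≤m ℓ p)

  split-position : ∀ a b p → p ≤ a + b → p ≤ a ⊎ Σ ℕ λ q → 1 ≤ q × q ≤ b × p ≡ a + q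
  split-position a b p p≤a+b with p ≤? a
  ... | yes p≤a = inj₁ p≤a
  ... | no p≰a  = inj₂ (p ∸ a , ℕP.m<n⇒0<n∸m a<p , offset≤b , sym (ℕP.m+[n∸m]≡n (ℕP.<⇒≤ a<p)))
    where
    a<p = ℕP.≰⇒> p≰a
    offset≤b : p ∸ a ≤ b
    offset≤b = subst (p ∸ a ≤_) (ℕP.m+n∸m≡n a b) (ℕP.∸-monoˡ-≤ a p≤a+b)

  module Concat {a b : ℕ} (W₁ : PathSeq a) (W₂ : PathSeq b) (glue : seq W₁ a ≡ seq W₂ 0)
                (meet : ∀ p q → p ≤ a → q ≤ b → seq W₁ p ≡ seq W₂ q → q ≡ 0) where

    concatSeq : ℕ → Fin n
    concatSeq p with p ≤? a
    ... | yes _ = seq W₁ p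
    ... | no _  = seq W₂ (p ∸ a)

    concat-left : ∀ {p} → p ≤ a → concatSeq p ≡ seq W₁ p
    concat-left {p} p≤a with p ≤? a
    ... | yes _  = refl
    ... | no p≰a = ⊥-elim (p≰a p≤a)

    concat-right : ∀ q → concatSeq (a + q) ≡ seq W₂ q
    concat-right q with a + q ≤? a
    ... | no _     = cong (seq W₂) (ℕP.m+n∸m≡n a q)
    ... | yes a+q≤a = begin
      seq W₁ (a + q)  ≡⟨ cong (seq W₁) (trans (cong (a +_) q≡0) (ℕP.+-identityʳ a)) ⟩
      seq W₁ a        ≡⟨ glue ⟩
      seq W₂ 0        ≡⟨ cong (seq W₂) q≡0 ⟨
      seq W₂ q        ∎
      where
      open ≡-Reasoning
      q≡0 : q ≡ 0
      q≡0 = ℕP.n≤0⇒n≡0 (ℕP.+-cancelˡ-≤ a q 0 (subst (a + q ≤_) (sym (ℕP.+-identityʳ a)) a+q≤a))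

    concat-adjacent : ∀ p → p < a + b → Adj G (concatSeq p) (concatSeq (suc p))
    concat-adjacent p p<a+b = by-block (suc p ≤? a)
      where
      by-block : Dec (suc p ≤ a) → Adj G (concatSeq p) (concatSeq (suc p))
      by-block (yes p<a) =
        subst₂ (Adj G) (sym (concat-left (ℕP.<⇒≤ p<a))) (sym (concat-left p<a)) (adjacent W₁ p p<a)
      by-block (no p≮a) =
        subst₂ (Adj G) (trans (sym (concat-right q)) (cong concatSeq a+q≡p))
                       (trans (sym (concat-right (suc q))) (cong concatSeq (trans (ℕP.+-suc a q) (cong suc a+q≡p))))
                       (adjacent W₂ q q<b)
        where
        q = p ∸ a
        a+q≡p : a + q ≡ p
        a+q≡p = ℕP.m+[n∸m]≡n (ℕP.≤-pred (ℕP.≰⇒> p≮a))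
        q<b : q < b
        q<b = ℕP.+-cancelˡ-< a q b (subst (_< a + b) (sym a+q≡p) p<a+b)

    concat-injective : ∀ p q → p ≤ a + b → q ≤ a + b → concatSeq p ≡ concatSeq q → p ≡ q
    concat-injective p q p≤ q≤ e with split-position a b p p≤ | split-position a b q q≤
    ... | inj₁ p≤a | inj₁ q≤a = injective W₁ p q p≤a q≤a (trans (sym (concat-left p≤a)) (trans e (concat-left q≤a)))
    ... | inj₂ (p' , _ , p'≤b , refl) | inj₂ (q' , _ , q'≤b , refl) =
      cong (a +_) (injective W₂ p' q' p'≤b q'≤b (trans (sym (concat-right p')) (trans e (concat-right q'))))
    ... | inj₁ p≤a | inj₂ (q' , 1≤q' , q'≤b , refl) =
      ⊥-elim (ℕP.<⇒≢ 1≤q' (sym (meet p q' p≤a q'≤b (trans (sym (concat-left p≤a)) (trans e (concat-right q'))))))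
    ... | inj₂ (p' , 1≤p' , p'≤b , refl) | inj₁ q≤a =
      ⊥-elim (ℕP.<⇒≢ 1≤p' (sym (meet q p' q≤a p'≤b (trans (sym (concat-left q≤a)) (trans (sym e) (concat-right p'))))))

    concat : PathSeq (a + b)
    concat = record { seq = concatSeq ; adjacent = concat-adjacent ; injective = concat-injective }

  -- Neighbours of v listed in vertex order; a neighbour is coded by its index there.
  neighbours : Fin n → List (Fin n)
  neighbours v = filterᵇ (SimpleGraph.adj G v) (allFin n)

  ∈-neighbours : ∀ {v u} → Adj G v u → u ∈ neighbours v
  ∈-neighbours {v} {u} = ∈P.∈-filter⁺ (λ w → T? (SimpleGraph.adj G v w)) (∈P.∈-allFin u)

  neighbourIndex : ∀ {v u} → Adj G v u → ℕ
  neighbourIndex vu = toℕ (Any.index (∈-neighbours vu))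

  neighbourIndex<degree : ∀ {v u} (vu : Adj G v u) → neighbourIndex vu < degree G v
  neighbourIndex<degree vu = FinP.toℕ<n (Any.index (∈-neighbours vu))

  neighbourIndex-injective : ∀ {v v' u u'} (vu : Adj G v u) (vu' : Adj G v' u') → v ≡ v' →
                             neighbourIndex vu ≡ neighbourIndex vu' → u ≡ u'
  neighbourIndex-injective vu vu' refl e =
    ∈ₛP.index-injective (setoid (Fin n)) (∈-neighbours vu) (∈-neighbours vu') (FinP.toℕ-injective e)

  maxDegree : Fin n → ℕ
  maxDegree v₀ = degree G (argmax (degree G) v₀ (allFin n))

  degree≤maxDegree : ∀ v₀ v → degree G v ≤ maxDegree v₀
  degree≤maxDegree v₀ v = All.lookup (f[xs]≤f[argmax] {f = degree G} v₀ (allFin n)) (∈P.∈-allFin v)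

  -- The p-th digit of a path: the index of its vertex p+1 among the
  -- neighbours of its vertex p.  A path is determined by its start and digits.
  digit : ∀ {ℓ} → DPath G ℓ → ℕ → ℕ
  digit {ℓ} P p with p <? ℓ
  ... | yes p<ℓ = neighbourIndex (at-adjacent P p<ℓ)
  ... | no _    = 0

  digit<bound : ∀ {d} → (∀ v → degree G v ≤ d) → ∀ {ℓ} (P : DPath G ℓ) {p} → p < ℓ → digit P p < d
  digit<bound deg≤d {ℓ} P {p} p<ℓ with p <? ℓ
  ... | yes p<ℓ' = ℕP.<-≤-trans (neighbourIndex<degree (at-adjacent P p<ℓ')) (deg≤d _)
  ... | no p≮ℓ   = ⊥-elim (p≮ℓ p<ℓ)

  digit-determines : ∀ {ℓ} (P Q : DPath G ℓ) {p} → p < ℓ → at P p ≡ at Q p →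
                     digit P p ≡ digit Q p → at P (suc p) ≡ at Q (suc p)
  digit-determines {ℓ} P Q {p} p<ℓ same-p same-digit with p <? ℓ
  ... | no p≮ℓ = ⊥-elim (p≮ℓ p<ℓ)
  ... | yes p<ℓ' = neighbourIndex-injective (at-adjacent P p<ℓ') (at-adjacent Q p<ℓ') same-p same-digit

  StepAgrees : ∀ {ℓ} → DPath G ℓ → DPath G ℓ → ℕ → Set
  StepAgrees P Q p = at P (suc p) ≡ at Q (suc p) ⊎ digit P p ≡ digit Q p

  agree-stepwise : ∀ {ℓ} (P Q : DPath G ℓ) → at P 0 ≡ at Q 0 →
                   (∀ p → p < ℓ → StepAgrees P Q p) →
                   ∀ p → p ≤ ℓ → at P p ≡ at Q p
  agree-stepwise P Q same-start next zero    _     = same-start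
  agree-stepwise P Q same-start next (suc p) p<ℓ with next p p<ℓ
  ... | inj₁ same-vertex = same-vertex
  ... | inj₂ same-digit  =
    digit-determines P Q p<ℓ (agree-stepwise P Q same-start next p (ℕP.<⇒≤ p<ℓ)) same-digit

  _∈?_ : (v : Fin n) (vs : List (Fin n)) → Dec (v ∈ vs)
  _∈?_ = DecMembership._∈?_
    where import Data.List.Membership.DecPropositional FinP._≟_ as DecMembership

  -- Only unblocked pairs can be extended to new x–y paths.
  module Blocking (i j : ℕ) (S : List (Fin n)) where

    data Blocked (P : DPath G i) (Q : DPath G j) : Set where
      P-hits-S  : ∀ t → 1 ≤ t → t ≤ i → at P t ∈ S → Blocked P Q
      Q-hits-S  : ∀ t → 1 ≤ t → t ≤ j → at Q t ∈ S → Blocked P Q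
      P-meets-Q : ∀ a b → 1 ≤ a → a ≤ i → 1 ≤ b → b ≤ j → at P a ≡ at Q b → Blocked P Q

    record Unblocked (P : DPath G i) (Q : DPath G j) : Set where
      field
        P-avoids-S : ∀ t → 1 ≤ t → t ≤ i → ¬ (at P t ∈ S)
        Q-avoids-S : ∀ t → 1 ≤ t → t ≤ j → ¬ (at Q t ∈ S)
        P-avoids-Q : ∀ a b → 1 ≤ a → a ≤ i → 1 ≤ b → b ≤ j → at P a ≢ at Q b

    classify : (P : DPath G i) (Q : DPath G j) → Unblocked P Q ⊎ Blocked P Q
    classify P Q with ℕP.anyUpTo? (λ t → at P (suc t) ∈? S) i
    ... | yes (t , t<i , hit) = inj₂ (P-hits-S (suc t) (s≤s z≤n) t<i hit)
    ... | no P-misses with ℕP.anyUpTo? (λ t → at Q (suc t) ∈? S) j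
    ...   | yes (t , t<j , hit) = inj₂ (Q-hits-S (suc t) (s≤s z≤n) t<j hit)
    ...   | no Q-misses with ℕP.anyUpTo? (λ a → ℕP.anyUpTo? (λ b → at P (suc a) FinP.≟ at Q (suc b)) j) i
    ...     | yes (a , a<i , b , b<j , e) = inj₂ (P-meets-Q (suc a) (suc b) (s≤s z≤n) a<i (s≤s z≤n) b<j e)
    ...     | no disjoint = inj₁ (record
      { P-avoids-S = λ { (suc t) _ t<i hit → P-misses (t , t<i , hit) }
      ; Q-avoids-S = λ { (suc t) _ t<j hit → Q-misses (t , t<j , hit) }
      ; P-avoids-Q = λ { (suc a) (suc b) _ a<i _ b<j e → disjoint (a , a<i , b , b<j , e) } })

    classify-all : ∀ {Info : DPath G i × DPath G j → Set} (L : List (DPath G i × DPath G j)) → All Info L →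
                   (Σ (DPath G i × DPath G j) λ e → Info e × Unblocked (proj₁ e) (proj₂ e)) ⊎
                   All (λ e → Blocked (proj₁ e) (proj₂ e) × Info e) L
    classify-all []             []             = inj₂ []
    classify-all ((P , Q) ∷ L) (info ∷ infos) with classify P Q
    ... | inj₁ unblocked = inj₁ ((P , Q) , info , unblocked)
    ... | inj₂ blocked with classify-all L infos
    ...   | inj₁ found       = inj₁ found
    ...   | inj₂ all-blocked = inj₂ ((blocked , info) ∷ all-blocked)

    -- Counting blocked pairs when all degrees are at most d: a blocked pair is
    -- coded by its blocking event (one of `events` many) together with the
    -- i + j - 1 digits of P and Q other than the one entering the blocking vertex.
    module Counting (d : ℕ) (deg≤d : ∀ v → degree G v ≤ d) where

      open Numeral d

      events : ℕ
      events = i * length S + j * length S + i * j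

      -- the digits of P followed by the digits of Q (the case split on p < i is
      -- passed explicitly, since `digit` splits on the same test)
      pairDigitBy : DPath G i → DPath G j → (p : ℕ) → Dec (p < i) → ℕ
      pairDigitBy P Q p (yes _) = digit P p
      pairDigitBy P Q p (no _)  = digit Q (p ∸ i)

      pairDigit : DPath G i → DPath G j → ℕ → ℕ
      pairDigit P Q p = pairDigitBy P Q p (p <? i)

      pairDigit-P : ∀ P Q {p} → p < i → pairDigit P Q p ≡ digit P p
      pairDigit-P P Q {p} p<i = by-cases (p <? i)
        where
        by-cases : (p<i? : Dec (p < i)) → pairDigitBy P Q p p<i? ≡ digit P p
        by-cases (yes _)  = refl
        by-cases (no p≮i) = ⊥-elim (p≮i p<i)

      pairDigit-Q : ∀ P Q q → pairDigit P Q (i + q) ≡ digit Q q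
      pairDigit-Q P Q q = by-cases (i + q <? i)
        where
        by-cases : (i+q<i? : Dec (i + q < i)) → pairDigitBy P Q (i + q) i+q<i? ≡ digit Q q
        by-cases (yes i+q<i) = ⊥-elim (ℕP.m+n≮m i q i+q<i)
        by-cases (no _)      = cong (digit Q) (ℕP.m+n∸m≡n i q)

      pairDigit<d : ∀ P Q p → p < i + j → pairDigit P Q p < d
      pairDigit<d P Q p p<i+j = by-cases (p <? i)
        where
        by-cases : (p<i? : Dec (p < i)) → pairDigitBy P Q p p<i? < d
        by-cases (yes p<i) = digit<bound deg≤d P p<i
        by-cases (no p≮i)  = digit<bound deg≤d Q (ℕP.+-cancelˡ-< i (p ∸ i) j
                               (subst (_< i + j) (sym (ℕP.m+[n∸m]≡n (ℕP.≮⇒≥ p≮i))) p<i+j))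

      position<bound : ∀ {t m} → 1 ≤ t → t ≤ m → t ∸ 1 < m
      position<bound {suc t} _ t<m = t<m

      S-index : ∀ {v} → v ∈ S → ℕ
      S-index v∈S = toℕ (Any.index v∈S)

      S-index<length : ∀ {v} (v∈S : v ∈ S) → S-index v∈S < length S
      S-index<length v∈S = FinP.toℕ<n (Any.index v∈S)

      S-index-injective : ∀ {v v'} (v∈S : v ∈ S) (v'∈S : v' ∈ S) → S-index v∈S ≡ S-index v'∈S → v ≡ v'
      S-index-injective v∈S v'∈S e = ∈ₛP.index-injective (setoid (Fin n)) v∈S v'∈S (FinP.toℕ-injective e)

      -- the position of the digit entering the blocking vertex
      forcedPosition : ∀ {P Q} → Blocked P Q → ℕ
      forcedPosition (P-hits-S t _ _ _)          = t ∸ 1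
      forcedPosition (Q-hits-S t _ _ _)          = i + (t ∸ 1)
      forcedPosition (P-meets-Q a b _ _ _ _ _)   = i + (b ∸ 1)

      forcedPosition<i+j : ∀ {P Q} (β : Blocked P Q) → forcedPosition β < i + j
      forcedPosition<i+j (P-hits-S t 1≤t t≤i _)        = ℕP.<-≤-trans (position<bound 1≤t t≤i) (ℕP.m≤m+n i j)
      forcedPosition<i+j (Q-hits-S t 1≤t t≤j _)        = ℕP.+-monoʳ-< i (position<bound 1≤t t≤j)
      forcedPosition<i+j (P-meets-Q a b _ _ 1≤b b≤j _) = ℕP.+-monoʳ-< i (position<bound 1≤b b≤j)

      -- the three kinds of events occupy consecutive ranges of codes
      eventCode : ∀ {P Q} → Blocked P Q → ℕ
      eventCode (P-hits-S t _ _ t∈S)        = (t ∸ 1) + i * S-index t∈S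
      eventCode (Q-hits-S t _ _ t∈S)        = i * length S + ((t ∸ 1) + j * S-index t∈S)
      eventCode (P-meets-Q a b _ _ _ _ _)   = i * length S + j * length S + ((a ∸ 1) + i * (b ∸ 1))

      P-hits-code< : ∀ {P Q} t 1≤t t≤i t∈S → eventCode {P} {Q} (P-hits-S t 1≤t t≤i t∈S) < i * length S
      P-hits-code< t 1≤t t≤i t∈S = radix-bound (position<bound 1≤t t≤i) (S-index<length t∈S)

      Q-hits-code< : ∀ {P Q} t 1≤t t≤j t∈S →
                     eventCode {P} {Q} (Q-hits-S t 1≤t t≤j t∈S) < i * length S + j * length S
      Q-hits-code< t 1≤t t≤j t∈S = ℕP.+-monoʳ-< (i * length S) (radix-bound (position<bound 1≤t t≤j) (S-index<length t∈S))

      eventCode<events : ∀ {P Q} (β : Blocked P Q) → eventCode β < events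
      eventCode<events {P} {Q} (P-hits-S t 1≤t t≤i t∈S) =
        ℕP.<-≤-trans (P-hits-code< {P} {Q} t 1≤t t≤i t∈S)
                     (ℕP.≤-trans (ℕP.m≤m+n _ (j * length S)) (ℕP.m≤m+n _ (i * j)))
      eventCode<events {P} {Q} (Q-hits-S t 1≤t t≤j t∈S) =
        ℕP.<-≤-trans (Q-hits-code< {P} {Q} t 1≤t t≤j t∈S) (ℕP.m≤m+n _ (i * j))
      eventCode<events (P-meets-Q a b 1≤a a≤i 1≤b b≤j _) =
        ℕP.+-monoʳ-< (i * length S + j * length S) (radix-bound (position<bound 1≤a a≤i) (position<bound 1≤b b≤j))

      freeDigits : ∀ {P Q} → Blocked P Q → ℕ
      freeDigits {P} {Q} β = numeral (pairDigit P Q) (positionsExcept (forcedPosition β) (i + j))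

      freeDigits< : ∀ {P Q} (β : Blocked P Q) → freeDigits β < d ^ (i + j ∸ 1)
      freeDigits< {P} {Q} β =
        subst (λ e → freeDigits β < d ^ e) (length-positionsExcept (forcedPosition<i+j β))
          (numeral-bound (pairDigit P Q) _ (All-positionsExcept (forcedPosition<i+j β) (pairDigit<d P Q)))

      code : ∀ {P Q} → Blocked P Q → ℕ
      code β = eventCode β + events * freeDigits β

      code< : ∀ {P Q} (β : Blocked P Q) → code β < events * d ^ (i + j ∸ 1)
      code< β = radix-bound (eventCode<events β) (freeDigits< β)

      module _ (P P' : DPath G i) (Q Q' : DPath G j)
               (same-x : at P 0 ≡ at P' 0) (same-y : at Q 0 ≡ at Q' 0) where

        Agree : Set
        Agree = (∀ p → p ≤ i → at P p ≡ at P' p) × (∀ q → q ≤ j → at Q q ≡ at Q' q)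

        FreeAgree : ℕ → Set
        FreeAgree u = ∀ p → p < i + j → p ≢ u → pairDigit P Q p ≡ pairDigit P' Q' p

        free-agree : ∀ {u} → u < i + j →
                     numeral (pairDigit P Q) (positionsExcept u (i + j)) ≡
                     numeral (pairDigit P' Q') (positionsExcept u (i + j)) → FreeAgree u
        free-agree u<i+j e p p<i+j p≢u =
          All.lookup (numeral-injective (pairDigit P Q) (pairDigit P' Q') _
                       (All-positionsExcept u<i+j (pairDigit<d P Q))
                       (All-positionsExcept u<i+j (pairDigit<d P' Q')) e)
                     (∈-positionsExcept p<i+j p≢u)

        P-digits : ∀ {u} → FreeAgree u → ∀ p → p < i → p ≢ u → digit P p ≡ digit P' p
        P-digits free p p<i p≢u = begin
          digit P p             ≡⟨ pairDigit-P P Q p<i ⟨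
          pairDigit P Q p       ≡⟨ free p (ℕP.<-≤-trans p<i (ℕP.m≤m+n i j)) p≢u ⟩
          pairDigit P' Q' p     ≡⟨ pairDigit-P P' Q' p<i ⟩
          digit P' p            ∎
          where open ≡-Reasoning

        Q-digits : ∀ {u} → FreeAgree u → ∀ q → q < j → i + q ≢ u → digit Q q ≡ digit Q' q
        Q-digits free q q<j i+q≢u = begin
          digit Q q             ≡⟨ pairDigit-Q P Q q ⟨
          pairDigit P Q (i + q) ≡⟨ free (i + q) (ℕP.+-monoʳ-< i q<j) i+q≢u ⟩
          pairDigit P' Q' (i + q) ≡⟨ pairDigit-Q P' Q' q ⟩
          digit Q' q            ∎
          where open ≡-Reasoning

        below≢above : ∀ {a b X} → a < X → X ≤ b → a ≢ b
        below≢above a<X X≤b refl = ℕP.<-irrefl refl (ℕP.<-≤-trans a<X X≤b)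

        suc≢⇒≢pred : ∀ {p t} → 1 ≤ t → suc p ≢ t → p ≢ t ∸ 1
        suc≢⇒≢pred {t = suc t} _ suc-p≢t p≡t = suc-p≢t (cong suc p≡t)

        -- Digits of P agree except at step t - 1, whose target agrees by the event.
        agree-P-hits : ∀ t → 1 ≤ t → t ≤ i → at P t ≡ at P' t → FreeAgree (t ∸ 1) → Agree
        agree-P-hits t 1≤t t≤i same-hit free = P-agree , Q-agree
          where
          P-agree = agree-stepwise P P' same-x λ p p<i → case-step p p<i (suc p ℕ.≟ t)
            where
            case-step : ∀ p → p < i → Dec (suc p ≡ t) → StepAgrees P P' p
            case-step p p<i (yes refl)  = inj₁ same-hit
            case-step p p<i (no suc-p≢t) = inj₂ (P-digits free p p<i (suc≢⇒≢pred 1≤t suc-p≢t))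
          Q-agree = agree-stepwise Q Q' same-y λ q q<j →
            inj₂ (Q-digits free q q<j (λ e → below≢above (position<bound 1≤t t≤i) (ℕP.m≤m+n i q) (sym e)))

        -- Digits of P agree; digits of Q agree except at step t - 1, whose
        -- target agrees by the event.
        agree-Q-hits : ∀ t → 1 ≤ t → t ≤ j → at Q t ≡ at Q' t → FreeAgree (i + (t ∸ 1)) → Agree
        agree-Q-hits t 1≤t t≤j same-hit free = P-agree , Q-agree
          where
          P-agree = agree-stepwise P P' same-x λ p p<i →
            inj₂ (P-digits free p p<i (below≢above p<i (ℕP.m≤m+n i (t ∸ 1))))
          Q-agree = agree-stepwise Q Q' same-y λ q q<j → case-step q q<j (suc q ℕ.≟ t)
            where
            case-step : ∀ q → q < j → Dec (suc q ≡ t) → StepAgrees Q Q' q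
            case-step q q<j (yes refl)   = inj₁ same-hit
            case-step q q<j (no suc-q≢t) =
              inj₂ (Q-digits free q q<j (suc≢⇒≢pred 1≤t suc-q≢t ∘ ℕP.+-cancelˡ-≡ i _ _))

        -- As above, but the target of step b - 1 of Q is vertex a of P,
        -- which is already known to agree.
        agree-P-meets : ∀ a b → a ≤ i → 1 ≤ b → at P a ≡ at Q b → at P' a ≡ at Q' b →
                        FreeAgree (i + (b ∸ 1)) → Agree
        agree-P-meets a b a≤i 1≤b meet meet' free = P-agree , Q-agree
          where
          P-agree = agree-stepwise P P' same-x λ p p<i →
            inj₂ (P-digits free p p<i (below≢above p<i (ℕP.m≤m+n i (b ∸ 1))))
          Q-agree = agree-stepwise Q Q' same-y λ q q<j → case-step q q<j (suc q ℕ.≟ b)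
            where
            case-step : ∀ q → q < j → Dec (suc q ≡ b) → StepAgrees Q Q' q
            case-step q q<j (yes refl)   = inj₁ (trans (sym meet) (trans (P-agree a a≤i) meet'))
            case-step q q<j (no suc-q≢b) =
              inj₂ (Q-digits free q q<j (suc≢⇒≢pred 1≤b suc-q≢b ∘ ℕP.+-cancelˡ-≡ i _ _))

        pred-injective : ∀ {t t'} → 1 ≤ t → 1 ≤ t' → t ∸ 1 ≡ t' ∸ 1 → t ≡ t'
        pred-injective {suc t} {suc t'} _ _ = cong suc

        -- Equal event codes force the same kind of event at the same positions;
        -- the three ranges of event codes are disjoint.
        same-code⇒agree : (β : Blocked P Q) (β' : Blocked P' Q') →
                          eventCode β ≡ eventCode β' → freeDigits β ≡ freeDigits β' → Agree
        same-code⇒agree β@(P-hits-S t 1≤t t≤i t∈S) (P-hits-S t' 1≤t' t'≤i t'∈S) same-event same-free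
          with radix-injective (position<bound 1≤t t≤i) (position<bound 1≤t' t'≤i) same-event
        ... | same-position , same-index with pred-injective 1≤t 1≤t' same-position
        ... | refl = agree-P-hits t 1≤t t≤i (S-index-injective t∈S t'∈S same-index)
                                  (free-agree (forcedPosition<i+j β) same-free)
        same-code⇒agree β@(Q-hits-S t 1≤t t≤j t∈S) (Q-hits-S t' 1≤t' t'≤j t'∈S) same-event same-free
          with radix-injective (position<bound 1≤t t≤j) (position<bound 1≤t' t'≤j)
                               (ℕP.+-cancelˡ-≡ (i * length S) _ _ same-event)
        ... | same-position , same-index with pred-injective 1≤t 1≤t' same-position
        ... | refl = agree-Q-hits t 1≤t t≤j (S-index-injective t∈S t'∈S same-index)
                                  (free-agree (forcedPosition<i+j β) same-free)
        same-code⇒agree β@(P-meets-Q a b 1≤a a≤i 1≤b b≤j meet) (P-meets-Q a' b' 1≤a' a'≤i 1≤b' b'≤j meet')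
                        same-event same-free
          with radix-injective (position<bound 1≤a a≤i) (position<bound 1≤a' a'≤i)
                               (ℕP.+-cancelˡ-≡ (i * length S + j * length S) _ _ same-event)
        ... | same-a , same-b with pred-injective 1≤a 1≤a' same-a | pred-injective 1≤b 1≤b' same-b
        ... | refl | refl = agree-P-meets a b a≤i 1≤b meet meet' (free-agree (forcedPosition<i+j β) same-free)
        same-code⇒agree (P-hits-S t 1≤t t≤i t∈S) (Q-hits-S _ _ _ _) same-event _ =
          ⊥-elim (below≢above (P-hits-code< {P} {Q} t 1≤t t≤i t∈S) (ℕP.m≤m+n (i * length S) _) same-event)
        same-code⇒agree (P-hits-S t 1≤t t≤i t∈S) (P-meets-Q _ _ _ _ _ _ _) same-event _ =
          ⊥-elim (below≢above (P-hits-code< {P} {Q} t 1≤t t≤i t∈S)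
                              (ℕP.≤-trans (ℕP.m≤m+n (i * length S) (j * length S)) (ℕP.m≤m+n _ _)) same-event)
        same-code⇒agree (Q-hits-S _ _ _ _) (P-hits-S t 1≤t t≤i t∈S) same-event _ =
          ⊥-elim (below≢above (P-hits-code< {P'} {Q'} t 1≤t t≤i t∈S) (ℕP.m≤m+n (i * length S) _) (sym same-event))
        same-code⇒agree (Q-hits-S t 1≤t t≤j t∈S) (P-meets-Q _ _ _ _ _ _ _) same-event _ =
          ⊥-elim (below≢above (Q-hits-code< {P} {Q} t 1≤t t≤j t∈S) (ℕP.m≤m+n (i * length S + j * length S) _) same-event)
        same-code⇒agree (P-meets-Q _ _ _ _ _ _ _) (P-hits-S t 1≤t t≤i t∈S) same-event _ =
          ⊥-elim (below≢above (P-hits-code< {P'} {Q'} t 1≤t t≤i t∈S)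
                              (ℕP.≤-trans (ℕP.m≤m+n (i * length S) (j * length S)) (ℕP.m≤m+n _ _)) (sym same-event))
        same-code⇒agree (P-meets-Q _ _ _ _ _ _ _) (Q-hits-S t 1≤t t≤j t∈S) same-event _ =
          ⊥-elim (below≢above (Q-hits-code< {P'} {Q'} t 1≤t t≤j t∈S)
                              (ℕP.m≤m+n (i * length S + j * length S) _) (sym same-event))

        code-injective : (β : Blocked P Q) (β' : Blocked P' Q') → code β ≡ code β' → Agree
        code-injective β β' e =
          let same-event , same-free = radix-injective (eventCode<events β) (eventCode<events β') e
          in same-code⇒agree β β' same-event same-free

      BlockedFrom : Fin n → Fin n → DPath G i × DPath G j → Set
      BlockedFrom x y (P , Q) = Blocked P Q × start G P ≡ x × start G Q ≡ y

      blocked-count : ∀ x y (L : List (DPath G i × DPath G j)) → AllPairs (PairDiffer G) L →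
                      All (BlockedFrom x y) L → length L ≤ events * d ^ (i + j ∸ 1)
      blocked-count x y = coded-pairwise-length≤ pairCode _ pairCode< pairCode-separates
        where
        pairCode : ∀ {e} → BlockedFrom x y e → ℕ
        pairCode (β , _) = code β
        pairCode< : ∀ {e} (b : BlockedFrom x y e) → pairCode b < events * d ^ (i + j ∸ 1)
        pairCode< (β , _) = code< β
        pairCode-separates : ∀ {e e'} (b : BlockedFrom x y e) (b' : BlockedFrom x y e') →
                             pairCode b ≡ pairCode b' → ¬ PairDiffer G e e'
        pairCode-separates {P , Q} {P' , Q'} (β , P-from , Q-from) (β' , P'-from , Q'-from) same
          with code-injective P P' Q Q' (same-start P P' P-from P'-from) (same-start Q Q' Q-from Q'-from) β β' same
          where
          same-start : ∀ {ℓ} (W W' : DPath G ℓ) {z} → start G W ≡ z → start G W' ≡ z → at W 0 ≡ at W' 0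
          same-start W W' W-from W'-from = trans (at-start W) (trans W-from (sym (trans (at-start W') W'-from)))
        ... | P-agree , Q-agree = [ agree⇒¬differ P P' P-agree , agree⇒¬differ Q Q' Q-agree ]

  module Splice {i j m ℓ : ℕ} (P : DPath G i) (Q : DPath G j) (R : DPath G m)
                (length≡ : i + m + j ≡ ℓ) (R-from : at R 0 ≡ at P i) (R-to : at R m ≡ at Q j)
                (P-Q : ∀ a b → a ≤ i → b ≤ j → at P a ≢ at Q b)
                (R-P : ∀ r a → 1 ≤ r → r < m → a ≤ i → at R r ≢ at P a)
                (R-Q : ∀ r b → 1 ≤ r → r < m → b ≤ j → at R r ≢ at Q b) where

    P-R-meet : ∀ p r → p ≤ i → r ≤ m → at P p ≡ at R r → r ≡ 0
    P-R-meet p zero    p≤i r≤m e = refl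
    P-R-meet p (suc r) p≤i r≤m e with suc r ℕ.≟ m
    ... | yes refl     = ⊥-elim (P-Q p j p≤i ℕP.≤-refl (trans e R-to))
    ... | no suc-r≢m   = ⊥-elim (R-P (suc r) p (s≤s z≤n) (ℕP.≤∧≢⇒< r≤m suc-r≢m) p≤i (sym e))

    module PR = Concat (toSeq P) (toSeq R) (sym R-from) P-R-meet

    Q⁻¹ : PathSeq j
    Q⁻¹ = reverse (toSeq Q)

    PR-Q⁻¹-glue : seq PR.concat (i + m) ≡ seq Q⁻¹ 0
    PR-Q⁻¹-glue = trans (PR.concat-right m) R-to

    PR-Q⁻¹-meet : ∀ p q → p ≤ i + m → q ≤ j → seq PR.concat p ≡ seq Q⁻¹ q → q ≡ 0
    PR-Q⁻¹-meet p q p≤i+m q≤j e with split-position i m p p≤i+m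
    ... | inj₁ p≤i = ⊥-elim (P-Q p (j ∸ q) p≤i (ℕP.m∸n≤m j q) (trans (sym (PR.concat-left p≤i)) e))
    ... | inj₂ (r , 1≤r , r≤m , refl) with r ℕ.≟ m
    ...   | no r≢m   = ⊥-elim (R-Q r (j ∸ q) 1≤r (ℕP.≤∧≢⇒< r≤m r≢m) (ℕP.m∸n≤m j q)
                                   (trans (sym (PR.concat-right r)) e))
    ...   | yes refl = sym (ℕP.∸-cancelˡ-≡ z≤n q≤j (at-injective Q ℕP.≤-refl (ℕP.m∸n≤m j q) end-of-Q))
      where
      end-of-Q : at Q j ≡ at Q (j ∸ q)
      end-of-Q = trans (sym R-to) (trans (sym (PR.concat-right m)) e)

    module PRQ = Concat PR.concat Q⁻¹ PR-Q⁻¹-glue PR-Q⁻¹-meet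

    spliced : PathSeq ℓ
    spliced = castSeq length≡ PRQ.concat

    spliced-start : seq spliced 0 ≡ at P 0
    spliced-start = begin
      seq spliced 0      ≡⟨ seq-castSeq length≡ PRQ.concat 0 ⟩
      seq PRQ.concat 0   ≡⟨ PRQ.concat-left z≤n ⟩
      seq PR.concat 0    ≡⟨ PR.concat-left z≤n ⟩
      at P 0             ∎
      where open ≡-Reasoning

    spliced-end : seq spliced ℓ ≡ at Q 0
    spliced-end = begin
      seq spliced ℓ              ≡⟨ seq-castSeq length≡ PRQ.concat ℓ ⟩
      seq PRQ.concat ℓ           ≡⟨ cong (seq PRQ.concat) length≡ ⟨
      seq PRQ.concat (i + m + j) ≡⟨ PRQ.concat-right j ⟩
      at Q (j ∸ j)               ≡⟨ cong (at Q) (ℕP.n∸n≡0 j) ⟩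
      at Q 0                     ∎
      where open ≡-Reasoning

    module _ (Ok : Fin n → Set) (P-ok : ∀ a → 1 ≤ a → a ≤ i → Ok (at P a))
             (R-ok : ∀ r → 1 ≤ r → r < m → Ok (at R r)) (Q-ok : ∀ b → 1 ≤ b → b ≤ j → Ok (at Q b)) where

      PR-ok : ∀ p → 1 ≤ p → p < i + m + j → p ≤ i ⊎ (Σ ℕ λ r → 1 ≤ r × r ≤ m × p ≡ i + r) →
              Ok (seq PR.concat p)
      PR-ok p 1≤p _ (inj₁ p≤i) = subst Ok (sym (PR.concat-left p≤i)) (P-ok p 1≤p p≤i)
      PR-ok p _ p<ℓ (inj₂ (r , 1≤r , r≤m , refl)) with r ℕ.≟ m
      ... | no r≢m   = subst Ok (sym (PR.concat-right r)) (R-ok r 1≤r (ℕP.≤∧≢⇒< r≤m r≢m))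
      ... | yes refl = subst Ok (sym (trans (PR.concat-right m) R-to)) (Q-ok j 1≤j ℕP.≤-refl)
        where
        1≤j : 1 ≤ j
        1≤j = ℕP.+-cancelˡ-< (i + m) 0 j (subst (_< i + m + j) (sym (ℕP.+-identityʳ (i + m))) p<ℓ)

      PRQ-ok : ∀ p → 1 ≤ p → p < i + m + j → p ≤ i + m ⊎ (Σ ℕ λ q → 1 ≤ q × q ≤ j × p ≡ i + m + q) →
               Ok (seq PRQ.concat p)
      PRQ-ok p 1≤p p<ℓ (inj₁ p≤i+m) =
        subst Ok (sym (PRQ.concat-left p≤i+m)) (PR-ok p 1≤p p<ℓ (split-position i m p p≤i+m))
      PRQ-ok p _ p<ℓ (inj₂ (q , _ , _ , refl)) =
        subst Ok (sym (PRQ.concat-right q)) (Q-ok (j ∸ q) (ℕP.m<n⇒0<n∸m q<j) (ℕP.m∸n≤m j q))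
        where
        q<j : q < j
        q<j = ℕP.+-cancelˡ-< (i + m) q j p<ℓ

      spliced-interior : ∀ p → 1 ≤ p → p < ℓ → Ok (seq spliced p)
      spliced-interior p 1≤p p<ℓ =
        subst Ok (sym (seq-castSeq length≡ PRQ.concat p))
          (PRQ-ok p 1≤p p<i+m+j (split-position (i + m) j p (ℕP.<⇒≤ p<i+m+j)))
        where
        p<i+m+j : p < i + m + j
        p<i+m+j = subst (p <_) (sym length≡) p<ℓ

  module _ {M m : ℕ} {u v : Fin n} (B : List (Fin n)) (ps : Fin M → PathBetween G m u v) where

    MeetsInterior : Fin M → Set
    MeetsInterior r = ∃ λ q → q < m × (1 ≤ q × at (proj₁ (ps r)) q ∈ B)

    meetsInterior? : ∀ r → Dec (MeetsInterior r)
    meetsInterior? r = ℕP.anyUpTo? (λ q → (1 ≤? q) ×-dec (at (proj₁ (ps r)) q ∈? B)) m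

  -- Fewer than M vertices cannot meet the interiors of all of M internally
  -- disjoint paths: some path of the family has its interior off the list B.
  avoiding-path : ∀ {M m u v} (B : List (Fin n)) → length B < M → (paths : DisjointPaths G M m u v) →
                  Σ (Fin M) λ r → ∀ q → 1 ≤ q → q < m → ¬ (at (proj₁ (proj₁ paths r)) q ∈ B)
  avoiding-path {M} B B<M (ps , disjoint) with FinP.all? (meetsInterior? B ps)
  ... | no ¬all-meet =
    let r , ¬meets = FinP.¬∀⟶∃¬ M (MeetsInterior B ps) (meetsInterior? B ps) ¬all-meet
    in r , λ q 1≤q q<m hit → ¬meets (q , q<m , 1≤q , hit)
  ... | yes all-meet with FinP.pigeonhole B<M (λ r → Any.index (proj₂ (proj₂ (proj₂ (all-meet r)))))
  ...   | r , r' , r<r' , same-index =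
    let q  , q<m  , 1≤q  , hit  = all-meet r
        q' , q'<m , 1≤q' , hit' = all-meet r'
    in ⊥-elim (internallyDisjoint⇒ (proj₁ (ps r)) (proj₁ (ps r')) (proj₂ (disjoint r r' r≢r'))
         q q' 1≤q q<m 1≤q' q'<m (∈ₛP.index-injective (setoid (Fin n)) hit hit' same-index))
    where
    r≢r' : r ≢ r'
    r≢r' r≡r' = ℕP.<⇒≢ r<r' (cong toℕ r≡r')

  connector : ∀ {i j m M} (B : List (Fin n)) (P : DPath G i) (Q : DPath G j) →
              length B + (suc i + suc j) < M → DisjointPaths G M m (end G P) (end G Q) →
              Σ (DPath G m) λ R → at R 0 ≡ at P i × at R m ≡ at Q j ×
                (∀ r → 1 ≤ r → r < m → ¬ (at R r ∈ B ++ (vertices P ++ vertices Q)))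
  connector {i} {j} {m} {M} B P Q enough connectors =
    R , trans (at-start R) (trans R-from (sym (at-end P))) , trans (at-end R) (trans R-to (sym (at-end Q))) , R-avoids
    where
    avoid = B ++ (vertices P ++ vertices Q)
    length-avoid : length avoid ≡ length B + (suc i + suc j)
    length-avoid = begin
      length (B ++ (vertices P ++ vertices Q))                ≡⟨ ListP.length-++ B ⟩
      length B + length (vertices P ++ vertices Q)            ≡⟨ cong (length B +_) (ListP.length-++ (vertices P)) ⟩
      length B + (length (vertices P) + length (vertices Q))
        ≡⟨ cong (length B +_) (cong₂ _+_ (length-vertices P) (length-vertices Q)) ⟩
      length B + (suc i + suc j)                              ∎
      where open ≡-Reasoning
    chosen = avoiding-path avoid (subst (_< M) (sym length-avoid) enough) connectors
    R = proj₁ (proj₁ connectors (proj₁ chosen))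
    R-from = proj₁ (proj₂ (proj₁ connectors (proj₁ chosen)))
    R-to = proj₂ (proj₂ (proj₁ connectors (proj₁ chosen)))
    R-avoids = proj₂ chosen

  module Growing {ℓ : ℕ} (2≤ℓ : 2 ≤ ℓ) {x y : Fin n} (x≢y : x ≢ y) where

    interior : DPath G ℓ → List (Fin n)
    interior P = List.map (at P) (applyUpTo suc (ℓ ∸ 1))

    ∈-interior : ∀ (P : DPath G ℓ) {p} → 1 ≤ p → p < ℓ → at P p ∈ interior P
    ∈-interior P {suc p} _ p<ℓ = ∈P.∈-map⁺ (at P) (∈P.∈-applyUpTo⁺ suc (ℕP.∸-monoˡ-< p<ℓ (s≤s z≤n)))

    interiors : ∀ t → (Fin t → PathBetween G ℓ x y) → List (Fin n)
    interiors zero    ps = []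
    interiors (suc t) ps = interior (proj₁ (ps zero)) ++ interiors t (ps ∘ suc)

    ∈-interiors : ∀ t (ps : Fin t → PathBetween G ℓ x y) r {p} → 1 ≤ p → p < ℓ →
                  at (proj₁ (ps r)) p ∈ interiors t ps
    ∈-interiors (suc t) ps zero    1≤p p<ℓ = ∈P.∈-++⁺ˡ (∈-interior (proj₁ (ps zero)) 1≤p p<ℓ)
    ∈-interiors (suc t) ps (suc r) 1≤p p<ℓ =
      ∈P.∈-++⁺ʳ (interior (proj₁ (ps zero))) (∈-interiors t (ps ∘ suc) r 1≤p p<ℓ)

    length-interiors : ∀ t (ps : Fin t → PathBetween G ℓ x y) → length (interiors t ps) ≡ t * (ℓ ∸ 1)
    length-interiors zero    ps = refl
    length-interiors (suc t) ps = begin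
      length (interior (proj₁ (ps zero)) ++ interiors t (ps ∘ suc))
        ≡⟨ ListP.length-++ (interior (proj₁ (ps zero))) ⟩
      length (interior (proj₁ (ps zero))) + length (interiors t (ps ∘ suc))
        ≡⟨ cong₂ _+_ (trans (ListP.length-map (at (proj₁ (ps zero))) (applyUpTo suc (ℓ ∸ 1)))
                            (ListP.length-applyUpTo suc (ℓ ∸ 1)))
                     (length-interiors t (ps ∘ suc)) ⟩
      (ℓ ∸ 1) + t * (ℓ ∸ 1) ∎
      where open ≡-Reasoning

    extend : ∀ t → (paths : DisjointPaths G t ℓ x y) → (W : DPath G ℓ) → start G W ≡ x → end G W ≡ y →
             (∀ p → 1 ≤ p → p < ℓ → ¬ (at W p ∈ interiors t (proj₁ paths))) →
             DisjointPaths G (suc t) ℓ x y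
    extend t (ps , disjoint) W W-from W-to avoids = ps' , disjoint'
      where
      ps' : Fin (suc t) → PathBetween G ℓ x y
      ps' zero    = W , W-from , W-to
      ps' (suc r) = ps r

      W≢ : ∀ r {p q} → 1 ≤ p → p < ℓ → 1 ≤ q → q < ℓ → at W p ≢ at (proj₁ (ps r)) q
      W≢ r 1≤p p<ℓ 1≤q q<ℓ e = avoids _ 1≤p p<ℓ (subst (_∈ _) (sym e) (∈-interiors t ps r 1≤q q<ℓ))

      new-old : ∀ r → Differ G W (proj₁ (ps r)) × InternallyDisjoint G W (proj₁ (ps r))
      new-old r = differ-at W (proj₁ (ps r)) (ℕP.<⇒≤ 2≤ℓ) (W≢ r ℕP.≤-refl 2≤ℓ ℕP.≤-refl 2≤ℓ) ,
                  ⇒internallyDisjoint W (proj₁ (ps r)) (λ p q 1≤p p<ℓ 1≤q q<ℓ → W≢ r 1≤p p<ℓ 1≤q q<ℓ)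

      old-new : ∀ r → Differ G (proj₁ (ps r)) W × InternallyDisjoint G (proj₁ (ps r)) W
      old-new r = differ-at (proj₁ (ps r)) W (ℕP.<⇒≤ 2≤ℓ) (W≢ r ℕP.≤-refl 2≤ℓ ℕP.≤-refl 2≤ℓ ∘ sym) ,
                  ⇒internallyDisjoint (proj₁ (ps r)) W (λ p q 1≤p p<ℓ 1≤q q<ℓ → W≢ r 1≤q q<ℓ 1≤p p<ℓ ∘ sym)

      disjoint' : ∀ a b → a ≢ b → Differ G (proj₁ (ps' a)) (proj₁ (ps' b)) ×
                                   InternallyDisjoint G (proj₁ (ps' a)) (proj₁ (ps' b))
      disjoint' zero    zero    a≢b = ⊥-elim (a≢b refl)
      disjoint' zero    (suc b) _   = new-old b
      disjoint' (suc a) zero    _   = old-new a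
      disjoint' (suc a) (suc b) a≢b = disjoint a b (a≢b ∘ cong suc)

    -- Vertices of an unblocked pair from x and y are all distinct, since the
    -- blocking list contains x and y.
    unblocked-disjoint : ∀ {i j} (used : List (Fin n)) (P : DPath G i) (Q : DPath G j) →
                         at P 0 ≡ x → at Q 0 ≡ y → Blocking.Unblocked i j (x ∷ y ∷ used) P Q →
                         ∀ a b → a ≤ i → b ≤ j → at P a ≢ at Q b
    unblocked-disjoint {i} {j} used P Q Px Qy unblocked = P-Q
      where
      open Blocking.Unblocked unblocked
      P-Q : ∀ a b → a ≤ i → b ≤ j → at P a ≢ at Q b
      P-Q zero    zero    _   _   e = x≢y (trans (sym Px) (trans e Qy))
      P-Q zero    (suc b) _   b≤j e = Q-avoids-S (suc b) (s≤s z≤n) b≤j (here (trans (sym e) Px))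
      P-Q (suc a) zero    a≤i _   e = P-avoids-S (suc a) (s≤s z≤n) a≤i (there (here (trans e Qy)))
      P-Q (suc a) (suc b) a≤i b≤j e = P-avoids-Q (suc a) (suc b) (s≤s z≤n) a≤i (s≤s z≤n) b≤j e

    new-path : ∀ {i j M} (used : List (Fin n)) → i + j < ℓ → length (x ∷ y ∷ used) + (suc i + suc j) < M →
               (P : DPath G i) (Q : DPath G j) → start G P ≡ x → start G Q ≡ y →
               DisjointPaths G M (ℓ ∸ (i + j)) (end G P) (end G Q) →
               Blocking.Unblocked i j (x ∷ y ∷ used) P Q →
               Σ (DPath G ℓ) λ W → start G W ≡ x × end G W ≡ y × (∀ p → 1 ≤ p → p < ℓ → ¬ (at W p ∈ used))
    new-path {i} {j} used i+j<ℓ enough P Q P-from Q-from connectors unblocked =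
      fromSeq spliced , trans spliced-start Px , trans (cong (seq spliced) (FinP.toℕ-fromℕ ℓ)) (trans spliced-end Qy) ,
      λ p 1≤p p<ℓ → subst (λ v → ¬ (v ∈ used)) (sym (at-fromSeq spliced p (ℕP.<⇒≤ p<ℓ)))
                          (spliced-interior (λ v → ¬ (v ∈ used)) P-off R-off Q-off p 1≤p p<ℓ)
      where
      open Blocking.Unblocked unblocked
      Px = trans (at-start P) P-from
      Qy = trans (at-start Q) Q-from
      m = ℓ ∸ (i + j)
      blocked = x ∷ y ∷ used
      R-data = connector blocked P Q enough connectors
      R = proj₁ R-data
      R-avoids = proj₂ (proj₂ (proj₂ R-data))
      R-P : ∀ r a → 1 ≤ r → r < m → a ≤ i → at R r ≢ at P a
      R-P r a 1≤r r<m a≤i e =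
        R-avoids r 1≤r r<m (∈P.∈-++⁺ʳ blocked (∈P.∈-++⁺ˡ (subst (_∈ _) (sym e) (∈-vertices P a≤i))))
      R-Q : ∀ r b → 1 ≤ r → r < m → b ≤ j → at R r ≢ at Q b
      R-Q r b 1≤r r<m b≤j e =
        R-avoids r 1≤r r<m (∈P.∈-++⁺ʳ blocked (∈P.∈-++⁺ʳ (vertices P) (subst (_∈ _) (sym e) (∈-vertices Q b≤j))))
      open Splice P Q R (pieces-length i j ℓ (ℕP.<⇒≤ i+j<ℓ))
                  (proj₁ (proj₂ R-data)) (proj₁ (proj₂ (proj₂ R-data)))
                  (unblocked-disjoint used P Q Px Qy unblocked) R-P R-Q
      P-off : ∀ a → 1 ≤ a → a ≤ i → ¬ (at P a ∈ used)
      P-off a 1≤a a≤i = P-avoids-S a 1≤a a≤i ∘ there ∘ there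
      R-off : ∀ r → 1 ≤ r → r < m → ¬ (at R r ∈ used)
      R-off r 1≤r r<m = R-avoids r 1≤r r<m ∘ ∈P.∈-++⁺ˡ ∘ there ∘ there
      Q-off : ∀ b → 1 ≤ b → b ≤ j → ¬ (at Q b ∈ used)
      Q-off b 1≤b b≤j = Q-avoids-S b 1≤b b≤j ∘ there ∘ there

  -- One greedy step for paths of length 2k.  If some counted pair (P, Q)
  -- is unblocked by x, y and the interiors of the family, it splices into a new
  -- path.  Otherwise every counted pair is blocked, and the number of blocked
  -- pairs, at most events · d^(i+j-1), falls short of the richness threshold.
  module _ {k vH d : ℕ} (1≤k : 1 ≤ k) (deg≤d : ∀ v → degree G v ≤ d)
           {D : ℚ} .{{_ : ℚ.NonZero D}} (d≤D : ℕ→ℚ d ℚ.≤ D)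
           {i j : ℕ} (i+j<2k : i + j < 2 * k) {x y : Fin n} (rich : Rich G k vH D i j x y) where

    Counted : DPath G i × DPath G j → Set
    Counted (P , Q) = start G P ≡ x × start G Q ≡ y × GoodPair G k vH D (P , Q)

    richCoeff-zero : i + j ≡ 0 → richCoeff G k vH D i j ≡ 0
    richCoeff-zero i+j≡0 with ℕP.m+n≡0⇒m≡0 i i+j≡0 | ℕP.m+n≡0⇒n≡0 i i+j≡0
    ... | refl | refl = refl

    rich-step : ∀ t → t < vH → DisjointPaths G t (2 * k) x y → DisjointPaths G (suc t) (2 * k) x y
    rich-step t t<vH family = by-classification (classify-all counted infos)
      where
      open Growing (ℕP.*-monoʳ-≤ 2 1≤k) (proj₁ rich)
      counted = proj₁ (proj₂ rich)
      different = proj₁ (proj₂ (proj₂ rich))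
      infos : All Counted counted
      infos = proj₁ (proj₂ (proj₂ (proj₂ rich)))
      many = proj₂ (proj₂ (proj₂ (proj₂ rich)))
      used = interiors t (proj₁ family)
      blocked-by = x ∷ y ∷ used
      open Blocking i j blocked-by
      X = 2 * k + 1
      blocked-by≤ : length blocked-by ≤ vH * X
      blocked-by≤ = subst₂ _≤_ (cong (2 +_) (sym (length-interiors t (proj₁ family))))
                              (cong (vH *_) (ℕP.+-comm 1 (2 * k)))
                              (used≤ t vH (2 * k) (ℕP.≤-trans (s≤s z≤n) (ℕP.*-monoʳ-≤ 2 1≤k)) t<vH)
      pair≤X : suc i + suc j ≤ X
      pair≤X = subst₂ _≤_ (sym (ℕP.+-suc (suc i) j)) (ℕP.+-comm 1 (2 * k)) (s≤s i+j<2k)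

      by-classification : (Σ (DPath G i × DPath G j) λ e → Counted e × Unblocked (proj₁ e) (proj₂ e)) ⊎
                          All (λ e → Blocked (proj₁ e) (proj₂ e) × Counted e) counted →
                          DisjointPaths G (suc t) (2 * k) x y
      by-classification (inj₁ ((P , Q) , (P-from , Q-from , connectors) , unblocked)) =
        let W , W-from , W-to , W-avoids =
              new-path used i+j<2k (enough-connectors _ i j vH X blocked-by≤ pair≤X)
                       P Q P-from Q-from connectors unblocked
        in extend t family W W-from W-to W-avoids
      by-classification (inj₂ all-blocked) = ⊥-elim (ℕP.<⇒≱ too-many at-most)
        where
        open Counting d deg≤d
        at-most : length counted ≤ events * d ^ (i + j ∸ 1)
        at-most = blocked-count x y counted different
                    (All.map (λ (β , P-from , Q-from , _) → β , P-from , Q-from) all-blocked)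
        too-many : events * d ^ (i + j ∸ 1) < length counted
        too-many = threshold⇒count d (richCoeff G k vH D i j) events (length counted) (i + j) D d≤D
                     (events≤coefficient i j (length blocked-by) vH X blocked-by≤) richCoeff-zero many

-- The paths are produced one at a time by the greedy step, with the degree
-- bound d taken to be the actual maximum degree (which is at most Kδ).
lemma4p2 : (k : ℕ) → k ≥ 1 → (F : Multigraph) → (K δ : ℚ) → .{{_ : Positive K}} → .{{_ : Positive δ}} → {n : ℕ} → (G : SimpleGraph n) → MaxDegreeAtMost G (K *ℚ δ) → (x y : Fin n) → (i j : ℕ) → i + j < 2 * k → Rich G k (subdivisionOrder F k) (K *ℚ δ) {{pos⇒nonZero (K *ℚ δ) {{pos*pos⇒pos K δ}}}} i j x y → DisjointPaths G (subdivisionOrder F k) (2 * k) x y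
lemma4p2 k 1≤k F K δ G max-degree x y i j i+j<2k rich = family (subdivisionOrder F k) ℕP.≤-refl
  where
  open InGraph G
  instance
    Kδ≢0 : ℚ.NonZero (K *ℚ δ)
    Kδ≢0 = pos⇒nonZero (K *ℚ δ) {{pos*pos⇒pos K δ}}
  family : ∀ t → t ≤ subdivisionOrder F k → DisjointPaths G t (2 * k) x y
  family zero    _    = (λ ()) , (λ ())
  family (suc t) t<vH = rich-step 1≤k (degree≤maxDegree x) (max-degree _) i+j<2k rich t t<vH
                                  (family t (ℕP.<⇒≤ t<vH))
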